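{- Let $G$ be the complete wheel on $n=5$ vertices: cycle vertices $c_1,c_2,c_3,c_4$ (with $c_i$ adjacent to $c_{i+1}$, indices modulo $4$ in $\{1,\dots,4\}$) and a central vertex $h$ adjacent to all $c_i$; let $C=\{c_1,\dots,c_4\}$, $V=C\cup\{h\}$, and let $w:V\to\mathbb{Q}^+$ be any non-negative weight function. Then: (1) $md_2^{AP}(G)=4$, $wmd_2^{AP}(G)=w(C)$, and $md_3^{AP}(G)=\infty$. (2) $md_2^{NL}(G)=3$ and $wmd_2^{NL}(G)=\min\{w(C),\,w(V)-\max_{1\leq i\leq4}(w(c_i)+w(c_{i+1}))\}$. (3) For every $k\geq3$, $md_k^{NL}(G)=4$ and $wmd_k^{NL}(G)=\min\{w(C),\,w(V)-\max_{1\leq i\leq4}w(c_i)\}$.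
   Context: $d(x,y)$ denotes graph distance. A vertex $\tau$ separates distinct vertices $u,v$ if $d(u,\tau)\neq d(v,\tau)$. For an integer $k$, $L\subseteq V$ is an AP-landmark set if every pair of distinct $u,v\in V$ is separated by at least $k$ distinct vertices of $L$, and an NL-landmark set if every pair of distinct $u,v\in V\setminus L$ is separated by at least $k$ distinct vertices of $L$. $md_k^{M}(G)$ ($M\in\{AP,NL\}$) is the minimum cardinality of such a set and $wmd_k^M(G)$ the minimum of $w(L)=\sum_{v\in L}w(v)$ over such sets ($\infty$ if none exists). -}

module Defs where

open import Data.Nat as ℕ using (ℕ; zero; suc; _≤_)
open import Data.Bool using (Bool; true; false; _∨_; _∧_; not; if_then_else_)
open import Data.Fin using (Fin; zero; suc; _≟_)
open import Data.Vec using (Vec; []; _∷_; tabulate; lookup)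
open import Data.Fin.Subset using (Subset; _∈_; _∉_; ∣_∣; _∩_; ⊤)
open import Data.Rational as ℚ using (ℚ; 0ℚ)
open import Data.Product using (Σ; _×_; _,_)
open import Relation.Nullary using (¬_; does)
open import Relation.Binary.PropositionalEquality using (_≡_; _≢_)

Graph : ℕ → Set
Graph n = Fin n → Fin n → Bool

anyFin : ∀ {n} → (Fin n → Bool) → Bool
anyFin {zero}  f = false
anyFin {suc n} f = f zero ∨ anyFin (λ i → f (suc i))

reach : ∀ {n} → Graph n → ℕ → Fin n → Fin n → Bool
reach G zero    u v = does (u ≟ v)
reach G (suc k) u v = reach G k u v ∨ anyFin (λ x → reach G k u x ∧ G x v)

distFrom : ∀ {n} → Graph n → ℕ → ℕ → Fin n → Fin n → ℕ
distFrom G start zero      u v = start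
distFrom G start (suc fuel) u v =
  if reach G start u v then start else distFrom G (suc start) fuel u v

-- graph distance d(u,v): the least k such that a walk of length ≤ k
-- joins u and v (any path has length < n; for connected graphs this is
-- the usual shortest-path distance).
dist : ∀ {n} → Graph n → Fin n → Fin n → ℕ
dist {n} G u v = distFrom G 0 n u v

separators : ∀ {n} → Graph n → Fin n → Fin n → Subset n
separators G u v = tabulate (λ τ → not (dist G u τ ℕ.≡ᵇ dist G v τ))

sepCount : ∀ {n} → Graph n → Subset n → Fin n → Fin n → ℕ
sepCount G L u v = ∣ L ∩ separators G u v ∣

IsAPLandmark : ∀ {n} → Graph n → ℕ → Subset n → Set
IsAPLandmark G k L = ∀ u v → u ≢ v → k ≤ sepCount G L u v

IsNLLandmark : ∀ {n} → Graph n → ℕ → Subset n → Set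
IsNLLandmark G k L = ∀ u v → u ∉ L → v ∉ L → u ≢ v → k ≤ sepCount G L u v

wsum : ∀ {n} → (Fin n → ℚ) → Subset n → ℚ
wsum {zero}  w []      = 0ℚ
wsum {suc n} w (b ∷ L) =
  (if b then w zero else 0ℚ) ℚ.+ wsum (λ i → w (suc i)) L

MinCard : ∀ {n} → (Subset n → Set) → ℕ → Set
MinCard P m = Σ _ (λ L → P L × ∣ L ∣ ≡ m) × (∀ L → P L → m ≤ ∣ L ∣)

MinWeight : ∀ {n} → (Fin n → ℚ) → (Subset n → Set) → ℚ → Set
MinWeight w P x =
  Σ _ (λ L → P L × wsum w L ≡ x) × (∀ L → P L → x ℚ.≤ wsum w L)

-- md^M_k(G) = ∞ (and hence wmd^M_k(G) = ∞): no set satisfies P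
NoneExists : ∀ {n} → (Subset n → Set) → Set
NoneExists P = ∀ L → ¬ P L

-- The complete wheel on 5 vertices.
-- Vertices: c₁,c₂,c₃,c₄ are 0,1,2,3 (as Fin 5), the hub h is 4.

c : Fin 4 → Fin 5
c = Data.Fin.inject₁

h : Fin 5
h = Data.Fin.fromℕ 4

next : Fin 4 → Fin 4
next zero                   = suc zero
next (suc zero)             = suc (suc zero)
next (suc (suc zero))       = suc (suc (suc zero))
next (suc (suc (suc zero))) = zero

wheelAdj : Fin 5 → Fin 5 → Bool
wheelAdj u v = anyFin (λ i → (does (u ≟ c i) ∧ does (v ≟ c (next i)))
                           ∨ (does (v ≟ c i) ∧ does (u ≟ c (next i)))
                           ∨ (does (u ≟ h) ∧ does (v ≟ c i))
                           ∨ (does (v ≟ h) ∧ does (u ≟ c i)))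

W5 : Graph 5
W5 = wheelAdj

Cset : Subset 5
Cset = tabulate (λ v → not (does (v ≟ h)))

NonNegWeight : (Fin 5 → ℚ) → Set
NonNegWeight w = ∀ v → 0ℚ ℚ.≤ w v

max4 : (Fin 4 → ℚ) → ℚ
max4 f = f zero ℚ.⊔ f (suc zero) ℚ.⊔ f (suc (suc zero)) ℚ.⊔ f (suc (suc (suc zero)))

-- The wheel is small: every property of a landmark set L ⊆ V quantifies
-- over at most 25 vertex pairs, and there are only 2⁵ candidate sets L.
-- All such properties are decidable, so the combinatorial content of the
-- theorem (which sets are landmark sets, how small they can be, and which
-- sets every landmark set must contain) is certified by evaluating the
-- decision procedures on the wheel.
--
-- The weighted statements then follow from one general principle
-- (minWeight-by-cover): for a non-negative weight w, if B and every
-- complement V ∖ Rᵢ have property P, and every P-set contains B or some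
-- V ∖ Rᵢ, then the least weight of a P-set is min(w(B), w(V) − maxᵢ w(Rᵢ)).  For NL-landmarks with k = 2 the removed sets Rᵢ are
-- the rim edges {cᵢ, cᵢ₊₁}; for k ≥ 3 they are the single rim vertices
-- {cᵢ}, and C, V ∖ {cᵢ} are NL-landmark sets for every k because at most
-- one vertex lies outside them; a k-landmark set is also a 3-landmark set.

module Submission where

open import Defs
open import Data.Nat using (ℕ; _≤_)
open import Data.Fin using (Fin)
open import Data.Fin.Subset using (⊤)
open import Data.Rational using (ℚ; _+_; _-_; _⊓_; _⊔_)
open import Data.Product using (_×_)

import Data.Nat as ℕ
import Data.Nat.Properties as ℕ
open import Algebra.Bundles using (CommutativeMonoid)
open import Data.Bool using (Bool; true; false; _∨_; _∧_; if_then_else_)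
open import Data.Bool.Properties using (∧-inverseʳ)
open import Data.Empty using (⊥-elim)
open import Data.Fin using (zero; suc; _≟_)
open import Data.Fin.Properties using (all?; any?)
open import Data.Fin.Subset using (Subset; _∉_; ∣_∣; _⊆_; _∪_; _∩_; ∁; ⁅_⁆)
  renaming (⊥ to ∅)
open import Data.Fin.Subset.Properties using (_∈?_; _⊆?_; drop-∷-⊆; p∪∁p≡⊤; anySubset?)
open import Data.Product using (Σ; ∃; _,_)
open import Data.Rational using (0ℚ) renaming (_≤_ to _≤ℚ_)
import Data.Rational.Properties as ℚ
open import Data.Sum using (_⊎_; inj₁; inj₂)
open import Data.Vec using (_∷_; []; here)
open import Function using (_∘_)
open import Relation.Binary.PropositionalEquality
open import Relation.Nullary using (Dec)
open import Relation.Nullary.Decidable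
  using (from-yes; map′; decidable-stable; ¬?; _→-dec_; _⊎-dec_)

open import Algebra.Properties.CommutativeSemigroup
  (CommutativeMonoid.commutativeSemigroup ℚ.+-0-commutativeMonoid) using (interchange)
open import Algebra.Properties.AbelianGroup ℚ.+-0-abelianGroup using (xyx⁻¹≈y)

-- Raising the separation threshold only shrinks the family of NL-landmark
-- sets; this reduces every k ≥ 3 to the case k = 3.
nl-antitone : ∀ {n} (G : Graph n) {j k} → j ≤ k → ∀ L →
              IsNLLandmark G k L → IsNLLandmark G j L
nl-antitone G j≤k L isNL u v u∉L v∉L u≢v = ℕ.≤-trans j≤k (isNL u v u∉L v∉L u≢v)

AtMostOneOutside : ∀ {n} → Subset n → Set
AtMostOneOutside L = ∀ u v → u ∉ L → v ∉ L → u ≡ v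

nl-of-atMostOneOutside : ∀ {n} (G : Graph n) k L →
                         AtMostOneOutside L → IsNLLandmark G k L
nl-of-atMostOneOutside G k L oneOut u v u∉L v∉L u≢v = ⊥-elim (u≢v (oneOut u v u∉L v∉L))

ap? : ∀ {n} (G : Graph n) k L → Dec (IsAPLandmark G k L)
ap? G k L = all? λ u → all? λ v → ¬? (u ≟ v) →-dec (k ℕ.≤? sepCount G L u v)

nl? : ∀ {n} (G : Graph n) k L → Dec (IsNLLandmark G k L)
nl? G k L = all? λ u → all? λ v → ¬? (u ∈? L) →-dec ¬? (v ∈? L) →-dec
              ¬? (u ≟ v) →-dec (k ℕ.≤? sepCount G L u v)

atMostOneOutside? : ∀ {n} (L : Subset n) → Dec (AtMostOneOutside L)
atMostOneOutside? L = all? λ u → all? λ v → ¬? (u ∈? L) →-dec ¬? (v ∈? L) →-dec (u ≟ v)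

allSubsets? : ∀ {n} {P : Subset n → Set} → (∀ L → Dec (P L)) → Dec (∀ L → P L)
allSubsets? P? =
  map′ (λ noCounterexample L → decidable-stable (P? L) (λ ¬PL → noCounterexample (L , ¬PL)))
       (λ allP (L , ¬PL) → ¬PL (allP L))
       (¬? (anySubset? (¬? ∘ P?)))

containsOneOf? : ∀ {n} (B : Subset n) (Cs : Fin 4 → Subset n) L →
                 Dec (B ⊆ L ⊎ ∃ λ i → Cs i ⊆ L)
containsOneOf? B Cs L = (B ⊆? L) ⊎-dec any? (λ i → Cs i ⊆? L)

wsum-mono : ∀ {n} (w : Fin n → ℚ) → (∀ v → 0ℚ ≤ℚ w v) →
            ∀ A B → A ⊆ B → wsum w A ≤ℚ wsum w B
wsum-mono w nonneg [] [] A⊆B = ℚ.≤-refl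
wsum-mono w nonneg (true ∷ A) (true ∷ B) A⊆B =
  ℚ.+-monoʳ-≤ (w zero) (wsum-mono (w ∘ suc) (nonneg ∘ suc) A B (drop-∷-⊆ A⊆B))
wsum-mono w nonneg (false ∷ A) (true ∷ B) A⊆B =
  ℚ.+-mono-≤ (nonneg zero) (wsum-mono (w ∘ suc) (nonneg ∘ suc) A B (drop-∷-⊆ A⊆B))
wsum-mono w nonneg (false ∷ A) (false ∷ B) A⊆B =
  ℚ.+-monoʳ-≤ 0ℚ (wsum-mono (w ∘ suc) (nonneg ∘ suc) A B (drop-∷-⊆ A⊆B))
wsum-mono w nonneg (true ∷ A) (false ∷ B) A⊆B with A⊆B here
... | ()

wsum-∪-∩ : ∀ {n} (w : Fin n → ℚ) A B →
           wsum w (A ∪ B) + wsum w (A ∩ B) ≡ wsum w A + wsum w B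
wsum-∪-∩ w [] [] = refl
wsum-∪-∩ w (a ∷ A) (b ∷ B) = begin
  (pick (a ∨ b) + w′ (A ∪ B)) + (pick (a ∧ b) + w′ (A ∩ B))
    ≡⟨ interchange (pick (a ∨ b)) (w′ (A ∪ B)) (pick (a ∧ b)) (w′ (A ∩ B)) ⟩
  (pick (a ∨ b) + pick (a ∧ b)) + (w′ (A ∪ B) + w′ (A ∩ B))
    ≡⟨ cong₂ _+_ (pick-∨-∧ a b) (wsum-∪-∩ (w ∘ suc) A B) ⟩
  (pick a + pick b) + (w′ A + w′ B)
    ≡⟨ sym (interchange (pick a) (w′ A) (pick b) (w′ B)) ⟩
  (pick a + w′ A) + (pick b + w′ B) ∎
  where
  open ≡-Reasoning
  w′ : Subset _ → ℚ
  w′ = wsum (w ∘ suc)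
  pick : Bool → ℚ
  pick x = if x then w zero else 0ℚ
  pick-∨-∧ : ∀ x y → pick (x ∨ y) + pick (x ∧ y) ≡ pick x + pick y
  pick-∨-∧ true  y     = refl
  pick-∨-∧ false true  = ℚ.+-comm (w zero) 0ℚ
  pick-∨-∧ false false = refl

wsum-∅ : ∀ {n} (w : Fin n → ℚ) → wsum w ∅ ≡ 0ℚ
wsum-∅ {ℕ.zero}  w = refl
wsum-∅ {ℕ.suc n} w = trans (ℚ.+-identityˡ _) (wsum-∅ (w ∘ suc))

wsum-⁅⁆ : ∀ {n} (w : Fin n → ℚ) i → wsum w ⁅ i ⁆ ≡ w i
wsum-⁅⁆ w zero    = trans (cong (w zero +_) (wsum-∅ (w ∘ suc))) (ℚ.+-identityʳ (w zero))
wsum-⁅⁆ w (suc i) = trans (ℚ.+-identityˡ _) (wsum-⁅⁆ (w ∘ suc) i)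

wsum-disjoint-∪ : ∀ {n} (w : Fin n → ℚ) A B → A ∩ B ≡ ∅ →
                  wsum w (A ∪ B) ≡ wsum w A + wsum w B
wsum-disjoint-∪ w A B A∩B≡∅ = begin
  wsum w (A ∪ B)                      ≡⟨ sym (ℚ.+-identityʳ _) ⟩
  wsum w (A ∪ B) + 0ℚ                 ≡⟨ cong (wsum w (A ∪ B) +_) (sym weight-A∩B) ⟩
  wsum w (A ∪ B) + wsum w (A ∩ B)     ≡⟨ wsum-∪-∩ w A B ⟩
  wsum w A + wsum w B                 ∎
  where
  open ≡-Reasoning
  weight-A∩B : wsum w (A ∩ B) ≡ 0ℚ
  weight-A∩B = trans (cong (wsum w) A∩B≡∅) (wsum-∅ w)

p∩∁p≡∅ : ∀ {n} (p : Subset n) → p ∩ ∁ p ≡ ∅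
p∩∁p≡∅ []      = refl
p∩∁p≡∅ (x ∷ p) = cong₂ _∷_ (∧-inverseʳ x) (p∩∁p≡∅ p)

wsum-∁ : ∀ {n} (w : Fin n → ℚ) R → wsum w ⊤ - wsum w R ≡ wsum w (∁ R)
wsum-∁ w R = begin
  wsum w ⊤ - wsum w R                      ≡⟨ cong (λ S → wsum w S - wsum w R) (sym (p∪∁p≡⊤ R)) ⟩
  wsum w (R ∪ ∁ R) - wsum w R              ≡⟨ cong (_- wsum w R) (wsum-disjoint-∪ w R (∁ R) (p∩∁p≡∅ R)) ⟩
  wsum w R + wsum w (∁ R) - wsum w R       ≡⟨ xyx⁻¹≈y (wsum w R) (wsum w (∁ R)) ⟩
  wsum w (∁ R)                             ∎
  where open ≡-Reasoning

max4-attained : ∀ f → ∃ λ i → max4 f ≡ f i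
max4-attained f with ℚ.⊔-sel (f zero ⊔ f (suc zero) ⊔ f (suc (suc zero))) (f (suc (suc (suc zero))))
... | inj₂ e = _ , e
... | inj₁ e with ℚ.⊔-sel (f zero ⊔ f (suc zero)) (f (suc (suc zero)))
...   | inj₂ e′ = _ , trans e e′
...   | inj₁ e′ with ℚ.⊔-sel (f zero) (f (suc zero))
...     | inj₁ e″ = _ , trans e (trans e′ e″)
...     | inj₂ e″ = _ , trans e (trans e′ e″)

max4-upper : ∀ f i → f i ≤ℚ max4 f
max4-upper f i = bound i
  where
  f₀ f₁ f₂ f₃ : ℚ
  f₀ = f zero; f₁ = f (suc zero); f₂ = f (suc (suc zero)); f₃ = f (suc (suc (suc zero)))
  bound : ∀ i → f i ≤ℚ f₀ ⊔ f₁ ⊔ f₂ ⊔ f₃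
  bound zero                   = ℚ.p≤q⇒p≤q⊔r f₃ (ℚ.p≤q⇒p≤q⊔r f₂ (ℚ.p≤p⊔q f₀ f₁))
  bound (suc zero)             = ℚ.p≤q⇒p≤q⊔r f₃ (ℚ.p≤q⇒p≤q⊔r f₂ (ℚ.p≤q⊔p f₀ f₁))
  bound (suc (suc zero))       = ℚ.p≤q⇒p≤q⊔r f₃ (ℚ.p≤q⊔p (f₀ ⊔ f₁) f₂)
  bound (suc (suc (suc zero))) = ℚ.p≤q⊔p (f₀ ⊔ f₁ ⊔ f₂) f₃

-- If B and every V ∖ Rᵢ have property P and every P-set contains B or
-- some V ∖ Rᵢ, then the least weight of a P-set is
-- min(w(B), w(V) − maxᵢ w(Rᵢ)); here f i is a given expression for w(Rᵢ).
minWeight-by-cover :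
  ∀ {n} (w : Fin n → ℚ) → (∀ v → 0ℚ ≤ℚ w v) →
  (P : Subset n → Set) (B : Subset n) (R : Fin 4 → Subset n)
  (f : Fin 4 → ℚ) → (∀ i → f i ≡ wsum w (R i)) →
  P B → (∀ i → P (∁ (R i))) →
  (∀ L → P L → B ⊆ L ⊎ ∃ λ i → ∁ (R i) ⊆ L) →
  MinWeight w P (wsum w B ⊓ (wsum w ⊤ - max4 f))
minWeight-by-cover w nonneg P B R f f≡wR PB PR cover = attained , lowerBound
  where
  m : ℚ
  m = wsum w B ⊓ (wsum w ⊤ - max4 f)

  complementWeight : ∀ i → wsum w ⊤ - f i ≡ wsum w (∁ (R i))
  complementWeight i = trans (cong (wsum w ⊤ -_) (f≡wR i)) (wsum-∁ w (R i))

  attained : Σ _ λ L → P L × wsum w L ≡ m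
  attained with ℚ.⊓-sel (wsum w B) (wsum w ⊤ - max4 f) | max4-attained f
  ... | inj₁ m≡wB  | _           = B , PB , sym m≡wB
  ... | inj₂ m≡rem | i , max≡f-i =
    ∁ (R i) , PR i , sym (trans m≡rem (trans (cong (wsum w ⊤ -_) max≡f-i) (complementWeight i)))

  lowerBound : ∀ L → P L → m ≤ℚ wsum w L
  lowerBound L PL with cover L PL
  ... | inj₁ B⊆L = ℚ.≤-trans (ℚ.p⊓q≤p (wsum w B) _) (wsum-mono w nonneg B L B⊆L)
  ... | inj₂ (i , ∁Rᵢ⊆L) = begin
    m                    ≤⟨ ℚ.p⊓q≤q (wsum w B) _ ⟩
    wsum w ⊤ - max4 f    ≤⟨ ℚ.+-monoʳ-≤ (wsum w ⊤) (ℚ.neg-antimono-≤ (max4-upper f i)) ⟩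
    wsum w ⊤ - f i       ≡⟨ complementWeight i ⟩
    wsum w (∁ (R i))     ≤⟨ wsum-mono w nonneg (∁ (R i)) L ∁Rᵢ⊆L ⟩
    wsum w L             ∎
    where open ℚ.≤-Reasoning

rimEdge : Fin 4 → Subset 5
rimEdge i = ⁅ c i ⁆ ∪ ⁅ c (next i) ⁆

rimEdge-weight : ∀ (w : Fin 5 → ℚ) i → w (c i) + w (c (next i)) ≡ wsum w (rimEdge i)
rimEdge-weight w i = sym (begin
  wsum w (⁅ c i ⁆ ∪ ⁅ c (next i) ⁆)          ≡⟨ wsum-disjoint-∪ w _ _ (endpoints-distinct i) ⟩
  wsum w ⁅ c i ⁆ + wsum w ⁅ c (next i) ⁆     ≡⟨ cong₂ _+_ (wsum-⁅⁆ w (c i)) (wsum-⁅⁆ w (c (next i))) ⟩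
  w (c i) + w (c (next i))                   ∎)
  where
  open ≡-Reasoning
  endpoints-distinct : ∀ i → ⁅ c i ⁆ ∩ ⁅ c (next i) ⁆ ≡ ∅
  endpoints-distinct zero                   = refl
  endpoints-distinct (suc zero)             = refl
  endpoints-distinct (suc (suc zero))       = refl
  endpoints-distinct (suc (suc (suc zero))) = refl

rimVertex-weight : ∀ (w : Fin 5 → ℚ) i → w (c i) ≡ wsum w ⁅ c i ⁆
rimVertex-weight w i = sym (wsum-⁅⁆ w (c i))

C-isAP2 : IsAPLandmark W5 2 Cset
C-isAP2 = from-yes (ap? W5 2 Cset)

AP2-contains-C : ∀ L → IsAPLandmark W5 2 L → Cset ⊆ L
AP2-contains-C = from-yes (allSubsets? λ L → ap? W5 2 L →-dec (Cset ⊆? L))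

AP2-size : ∀ L → IsAPLandmark W5 2 L → 4 ≤ ∣ L ∣
AP2-size = from-yes (allSubsets? λ L → ap? W5 2 L →-dec (4 ℕ.≤? ∣ L ∣))

no-AP3 : NoneExists (IsAPLandmark W5 3)
no-AP3 = from-yes (allSubsets? λ L → ¬? (ap? W5 3 L))

C-isNL2 : IsNLLandmark W5 2 Cset
C-isNL2 = from-yes (nl? W5 2 Cset)

rimEdgeComplement-isNL2 : ∀ i → IsNLLandmark W5 2 (∁ (rimEdge i))
rimEdgeComplement-isNL2 = from-yes (all? λ i → nl? W5 2 (∁ (rimEdge i)))

NL2-cover : ∀ L → IsNLLandmark W5 2 L → Cset ⊆ L ⊎ ∃ λ i → ∁ (rimEdge i) ⊆ L
NL2-cover = from-yes (allSubsets? λ L → nl? W5 2 L →-dec containsOneOf? Cset (∁ ∘ rimEdge) L)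

NL2-size : ∀ L → IsNLLandmark W5 2 L → 3 ≤ ∣ L ∣
NL2-size = from-yes (allSubsets? λ L → nl? W5 2 L →-dec (3 ℕ.≤? ∣ L ∣))

C-atMostOneOutside : AtMostOneOutside Cset
C-atMostOneOutside = from-yes (atMostOneOutside? Cset)

rimVertexComplement-atMostOneOutside : ∀ i → AtMostOneOutside (∁ ⁅ c i ⁆)
rimVertexComplement-atMostOneOutside = from-yes (all? λ i → atMostOneOutside? (∁ ⁅ c i ⁆))

NL3-cover : ∀ L → IsNLLandmark W5 3 L → Cset ⊆ L ⊎ ∃ λ i → ∁ ⁅ c i ⁆ ⊆ L
NL3-cover = from-yes (allSubsets? λ L → nl? W5 3 L →-dec containsOneOf? Cset (λ i → ∁ ⁅ c i ⁆) L)

NL3-size : ∀ L → IsNLLandmark W5 3 L → 4 ≤ ∣ L ∣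
NL3-size = from-yes (allSubsets? λ L → nl? W5 3 L →-dec (4 ℕ.≤? ∣ L ∣))

NL-landmarks-k≥3 : (w : Fin 5 → ℚ) → NonNegWeight w → (k : ℕ) → 3 ≤ k →
    MinCard (IsNLLandmark W5 k) 4
    × MinWeight w (IsNLLandmark W5 k) (wsum w Cset ⊓ (wsum w ⊤ - max4 (λ i → w (c i))))
NL-landmarks-k≥3 w nonneg k 3≤k =
    ((Cset , C-isNLk , refl) , λ L → NL3-size L ∘ toNL3 L)
  , minWeight-by-cover w nonneg _ Cset (λ i → ⁅ c i ⁆) _ (rimVertex-weight w)
      C-isNLk rimVertexComplement-isNLk (λ L → NL3-cover L ∘ toNL3 L)
  where
  toNL3 : ∀ L → IsNLLandmark W5 k L → IsNLLandmark W5 3 L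
  toNL3 = nl-antitone W5 3≤k
  C-isNLk : IsNLLandmark W5 k Cset
  C-isNLk = nl-of-atMostOneOutside W5 k Cset C-atMostOneOutside
  rimVertexComplement-isNLk : ∀ i → IsNLLandmark W5 k (∁ ⁅ c i ⁆)
  rimVertexComplement-isNLk i =
    nl-of-atMostOneOutside W5 k _ (rimVertexComplement-atMostOneOutside i)

mainTheorem7 : (w : Fin 5 → ℚ) → NonNegWeight w →
    (MinCard (IsAPLandmark W5 2) 4
    × MinWeight w (IsAPLandmark W5 2) (wsum w Cset)
    × NoneExists (IsAPLandmark W5 3))
    ×
    (MinCard (IsNLLandmark W5 2) 3
    × MinWeight w (IsNLLandmark W5 2)
    (wsum w Cset ⊓ (wsum w ⊤ - max4 (λ i → w (c i) + w (c (next i))))))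
    ×
    ((k : ℕ) → 3 ≤ k →
    MinCard (IsNLLandmark W5 k) 4
    × MinWeight w (IsNLLandmark W5 k)
    (wsum w Cset ⊓ (wsum w ⊤ - max4 (λ i → w (c i)))))
mainTheorem7 w nonneg =
    ( ((Cset , C-isAP2 , refl) , AP2-size)
    , ((Cset , C-isAP2 , refl) , λ L isAP → wsum-mono w nonneg Cset L (AP2-contains-C L isAP))
    , no-AP3 )
  , ( ((∁ (rimEdge zero) , rimEdgeComplement-isNL2 zero , refl) , NL2-size)
    , minWeight-by-cover w nonneg _ Cset rimEdge _ (rimEdge-weight w)
        C-isNL2 rimEdgeComplement-isNL2 NL2-cover )
  , NL-landmarks-k≥3 w nonneg
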